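{- For $n\ge3$, the posets $\mathcal{FL}yn_n^w$ and $\mathcal{SF}_n$ are not isomorphic.
   Context: $\mathcal{SF}_n$ is the poset of rooted spanning forests on vertex set $[n]$ (forests of rooted trees whose vertex set is $[n]$), with $F\lessdot F'$ iff $F'$ is obtained from $F$ by joining the roots of two of its trees by an edge and declaring one of these two roots to be the root of the new tree; its minimum is the forest of $n$ isolated rooted vertices. Trees: a bicolored binary forest on $[n]$ is a forest of rooted planar binary trees (left child $L(v)$, right child $R(v)$) with leaves bijectively labeled by $[n]$ and internal vertices colored in $\{0,1\}$. $\nu(v)$ is the smallest leaf label below $v$; normalized means $\nu(v)=\nu(L(v))$ for all internal $v$; $v$ is Lyndon if $L(v)$ is a leaf or $\nu(R(L(v)))>\nu(R(v))$. A normalized tree is a bicolored Lyndon tree if every internal $v$ whose left child is internal is Lyndon or satisfies $\mathrm{color}(L(v))>\mathrm{color}(v)$. To $u$-merge two bicolored Lyndon trees $T_1,T_2$ (min leaf of $T_1$ smaller), create a new vertex $r$ of color $u$ with left child the root of $T_1$ and right child the root of $T_2$; while the result is not a bicolored Lyndon tree, replace the subtree $r(x(X_L,X_R),Y)$ by $x(r(X_L,Y),X_R)$, colors kept. $\mathcal{FL}yn_n^w$ is the set of forests on $[n]$ whose components are bicolored Lyndon trees, with $F\lessdot F'$ iff $F'$ arises from $F$ by $u$-merging exactly two trees, $u\in\{0,1\}$. -}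

module Defs where

open import Data.Bool using (Bool; true; false; _∧_; _∨_; not; T)
open import Data.Nat using (ℕ; zero; suc; _⊓_; _≡ᵇ_; _<ᵇ_; _+_)
open import Data.Fin using (Fin; toℕ)
open import Data.Fin.Properties using (_≟_)
open import Data.Maybe using (Maybe; just; nothing)
open import Data.List using (List; []; _∷_; _++_; allFin)
open import Data.Vec using (Vec; lookup; _[_]≔_; toList)
import Data.Vec as Vec
open import Data.Product using (Σ; ∃; ∃-syntax; _×_; proj₁; _,_)
open import Relation.Nullary using (¬_; does)
open import Relation.Binary.PropositionalEquality using (_≡_)
open import Relation.Binary.Construct.Closure.ReflexiveTransitive using (Star)
open import Relation.Binary.Morphism.Structures using (IsOrderIsomorphism)

-- A rooted forest on [n] is given by its parent map:
-- (lookup p i = nothing) iff i is a root, (lookup p i = just j) iff j is the parent of i.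
-- Boolean "for all elements of the list"
allB : {A : Set} → (A → Bool) → List A → Bool
allB p [] = true
allB p (x ∷ xs) = p x ∧ allB p xs

ParentMap : ℕ → Set
ParentMap n = Vec (Maybe (Fin n)) n

reachesRoot : ∀ {n} → ParentMap n → ℕ → Fin n → Bool
reachesRoot p fuel i with lookup p i
... | nothing = true
... | just j with fuel
...   | zero   = false
...   | suc k  = reachesRoot p k j

-- The parent map is acyclic (hence a forest of rooted trees): every vertex
-- reaches a root within n steps.
isForest : ∀ {n} → ParentMap n → Bool
isForest {n} p = allB (reachesRoot p n) (allFin n)

SF : ℕ → Set
SF n = Σ (ParentMap n) (λ p → T (isForest p))

_⋖SF_ : ∀ {n} → SF n → SF n → Set
_⋖SF_ {n} F F' = ∃[ a ] ∃[ b ] (¬ a ≡ b × lookup (proj₁ F) a ≡ nothing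
                   × lookup (proj₁ F) b ≡ nothing
                   × proj₁ F' ≡ (proj₁ F [ a ]≔ just b))

_≤SF_ : ∀ {n} → SF n → SF n → Set
_≤SF_ = Star _⋖SF_

-- Colors {0,1}: false = 0, true = 1.
Color : Set
Color = Bool

_>ᶜ_ : Color → Color → Bool
c' >ᶜ c = c' ∧ not c

data Tree (n : ℕ) : Set where
  leaf : Fin n → Tree n
  node : Color → Tree n → Tree n → Tree n

leaves : ∀ {n} → Tree n → List (Fin n)
leaves (leaf i) = i ∷ []
leaves (node _ L R) = leaves L ++ leaves R

ν : ∀ {n} → Tree n → ℕ
ν (leaf i) = toℕ i
ν (node _ L R) = ν L ⊓ ν R

isLyndonAt : ∀ {n} → Color → Tree n → Tree n → Bool
isLyndonAt c (leaf _) R = true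
isLyndonAt c (node c' LL LR) R = ν R <ᵇ ν LR

bicolorCond : ∀ {n} → Color → Tree n → Tree n → Bool
bicolorCond c (leaf _) R = true
bicolorCond c (node c' LL LR) R = isLyndonAt c (node c' LL LR) R ∨ (c' >ᶜ c)

isBLT : ∀ {n} → Tree n → Bool
isBLT (leaf _) = true
isBLT (node c L R) =
  isBLT L ∧ isBLT R ∧ (ν (node c L R) ≡ᵇ ν L) ∧ bicolorCond c L R

size : ∀ {n} → Tree n → ℕ
size (leaf _) = 0
size (node _ L R) = suc (size L + size R)

-- A context: the path of vertices x above the current subtree, each recorded
-- with its color and right subtree (innermost first); the current subtree is
-- always the left child.
Ctx : ℕ → Set
Ctx n = List (Color × Tree n)

plug : ∀ {n} → Ctx n → Tree n → Tree n
plug [] t = t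
plug ((c , R) ∷ ctx) t = plug ctx (node c t R)

-- The merging loop: while the whole tree is not a bicolored Lyndon tree,
-- replace the subtree r(x(X_L,X_R),Y) (r the new vertex) by x(r(X_L,Y),X_R).
-- Fuel bounds the number of rotations (each moves r one step down the left
-- spine of T₁, so size T₁ suffices); if no rotation is possible the loop stops.
mergeLoop : ∀ {n} → ℕ → Ctx n → Tree n → Tree n
mergeLoop fuel ctx t with isBLT (plug ctx t)
... | true = plug ctx t
... | false with fuel | t
...   | suc k | node u (node c XL XR) Y = mergeLoop k ((c , XR) ∷ ctx) (node u XL Y)
...   | _     | _ = plug ctx t

-- u-merge of T₁, T₂ (T₁ having the smaller minimal leaf)
merge : ∀ {n} → Color → Tree n → Tree n → Tree n
merge u T₁ T₂ = mergeLoop (size T₁) [] (node u T₁ T₂)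

-- A forest on [n] is stored canonically, indexing each tree by its minimal
-- leaf label: position i holds the tree whose minimal leaf is i, or nothing
-- if i is not the minimal leaf of any tree.
RawForest : ℕ → Set
RawForest n = Vec (Maybe (Tree n)) n

count : ∀ {n} → Fin n → List (Fin n) → ℕ
count i [] = 0
count i (j ∷ js) with does (i ≟ j)
... | true = suc (count i js)
... | false = count i js

forestLeaves : ∀ {n} → List (Maybe (Tree n)) → List (Fin n)
forestLeaves [] = []
forestLeaves (nothing ∷ ts) = forestLeaves ts
forestLeaves (just t ∷ ts) = leaves t ++ forestLeaves ts

slotOK : ∀ {n} → Fin n → Maybe (Tree n) → Bool
slotOK i nothing = true
slotOK i (just t) = (ν t ≡ᵇ toℕ i) ∧ isBLT t

isFLyn : ∀ {n} → RawForest n → Bool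
isFLyn {n} F =
  allB (λ i → slotOK i (lookup F i)) (allFin n)
  ∧ allB (λ i → count i (forestLeaves (toList F)) ≡ᵇ 1) (allFin n)

FLyn : ℕ → Set
FLyn n = Σ (RawForest n) (λ F → T (isFLyn F))

_⋖FL_ : ∀ {n} → FLyn n → FLyn n → Set
_⋖FL_ {n} F F' =
  ∃[ i ] ∃[ j ] ∃[ Tᵢ ] ∃[ Tⱼ ] ∃[ u ]
    (T (toℕ i <ᵇ toℕ j)
    × lookup (proj₁ F) i ≡ just Tᵢ
    × lookup (proj₁ F) j ≡ just Tⱼ
    × proj₁ F' ≡ ((proj₁ F [ i ]≔ just (merge u Tᵢ Tⱼ)) [ j ]≔ nothing))

_≤FL_ : ∀ {n} → FLyn n → FLyn n → Set
_≤FL_ = Star _⋖FL_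

PosetIsomorphic : ℕ → Set
PosetIsomorphic n =
  ∃[ φ ] IsOrderIsomorphism {A = FLyn n} {B = SF n} _≡_ _≡_ _≤FL_ _≤SF_ φ

-- In SF_n every cover joins two roots, so the number of trees drops by one
-- along each cover. Take two diamonds F₀ ⋖ X ⋖ Z and F₀ ⋖ Y ⋖ Z (Y ≠ X) with
-- the same lower edge F₀ ⋖ X, where F₀ has three trees. If F₀ ⋖ X attaches a
-- under b, then X ⋖ Z cannot move b (Z would cover no second upper cover of
-- F₀), so it attaches the other root of X under b: both diamonds have the same
-- top. In FLyn_n^w the forest F₀ = {0}, {1}, comb(2, …, n−1) lies n − 3 covers
-- above the bottom, so an isomorphism sends it to a forest with at most three
-- trees; yet F₀ has two such diamonds with distinct tops, the 0- and the
-- 1-merge of 1(0, comb) with 1.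
module Submission where

open import Defs
open import Data.Bool using (Bool; true; false; T; if_then_else_)
open import Data.Bool.Properties using (T-∧; T-≡; T-irrelevant; ∧-zeroʳ)
open import Data.Empty using (⊥; ⊥-elim)
open import Data.Fin using (Fin; zero; suc; toℕ)
open import Data.Fin.Properties using (_≟_)
open import Data.List using (List; []; _∷_; _++_; allFin; tabulate; map)
open import Data.List.Properties using (++-assoc; ++-identityʳ; map-tabulate)
open import Data.List.Relation.Binary.Permutation.Propositional as Perm using (_↭_; ↭-reflexive; ↭-trans)
open import Data.List.Relation.Binary.Permutation.Propositional.Properties using (shift)
open import Data.Maybe using (Maybe; just; nothing)
open import Data.Maybe.Properties using (just-injective)
open import Data.Nat using (ℕ; zero; suc; _+_; _⊓_; _≤_; _<_; z≤n; s≤s; z<s)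
open import Data.Nat.Properties
  using (≤-refl; <⇒≤; ≤-reflexive; ≤-trans; ≤-antisym; ≤-pred; ≤⇒≯; <-irrefl; 1+n≢n; n<1+n;
         m<n⇒m<1+n; m≤n⇒m≤1+n; m≤m+n; +-suc; +-comm; +-identityʳ; +-cancelʳ-≤; m≤n⇒m⊓n≡m;
         ≡⇒≡ᵇ; <⇒<ᵇ; module ≤-Reasoning)
open import Data.Product using (∃-syntax; _×_; _,_; proj₁)
open import Data.Vec using (Vec; []; _∷_; lookup; _[_]≔_; replicate; toList)
open import Data.Vec.Properties using (lookup∘update; lookup∘update′; lookup-replicate)
open import Function using (_∘_; id)
open import Function.Bundles using (Equivalence)
open import Relation.Nullary using (¬_; yes; no; does)
open import Relation.Binary.PropositionalEquality
  using (_≡_; refl; sym; trans; cong; cong₂; subst; module ≡-Reasoning)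
open import Relation.Binary.Construct.Closure.ReflexiveTransitive using (Star; ε; _◅_)
open import Relation.Binary.Morphism.Structures using (IsOrderIsomorphism)

open Equivalence using (to; from)

just≢nothing : ∀ {A : Set} {x : A} → ¬ just x ≡ nothing
just≢nothing ()

StrictlyBelow : {A : Set} → (A → A → Set) → A → A → Set
StrictlyBelow R x y = Star R x y × ¬ x ≡ y

record Diamond {A : Set} (R : A → A → Set) (bottom left right top : A) : Set where
  field
    bottom<left  : StrictlyBelow R bottom left
    left<top     : StrictlyBelow R left top
    bottom<right : StrictlyBelow R bottom right
    right<top    : StrictlyBelow R right top
    left≢right   : ¬ left ≡ right

module _ {A B : Set} {R : A → A → Set} {S : B → B → Set} {f : A → B}
         (mono : ∀ {x y} → Star R x y → Star S (f x) (f y))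
         (injective : ∀ {x y} → f x ≡ f y → x ≡ y) where

  strictlyBelow-map : ∀ {x y} → StrictlyBelow R x y → StrictlyBelow S (f x) (f y)
  strictlyBelow-map (x≤y , x≢y) = mono x≤y , x≢y ∘ injective

  diamond-map : ∀ {b l r t} → Diamond R b l r t → Diamond S (f b) (f l) (f r) (f t)
  diamond-map D = record
    { bottom<left  = strictlyBelow-map bottom<left
    ; left<top     = strictlyBelow-map left<top
    ; bottom<right = strictlyBelow-map bottom<right
    ; right<top    = strictlyBelow-map right<top
    ; left≢right   = left≢right ∘ injective
    }
    where open Diamond D

module Graded {A : Set} {R : A → A → Set} (ρ : A → ℕ)
              (ρ-cover : ∀ {x y} → R x y → suc (ρ y) ≡ ρ x) where

  rank-step : ∀ {x y} → R x y → ρ y < ρ x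
  rank-step r = ≤-reflexive (ρ-cover r)

  rank-antitone : ∀ {x y} → Star R x y → ρ y ≤ ρ x
  rank-antitone ε       = ≤-refl
  rank-antitone (r ◅ s) = ≤-trans (rank-antitone s) (<⇒≤ (rank-step r))

  rank-decreases : ∀ {x y} → StrictlyBelow R x y → ρ y < ρ x
  rank-decreases (ε , x≢x)   = ⊥-elim (x≢x refl)
  rank-decreases (r ◅ s , _) = ≤-trans (s≤s (rank-antitone s)) (rank-step r)

  rank-drop-one⇒cover : ∀ {x y} → Star R x y → suc (ρ y) ≡ ρ x → R x y
  rank-drop-one⇒cover ε           drop = ⊥-elim (1+n≢n drop)
  rank-drop-one⇒cover (r ◅ ε)     _    = r
  rank-drop-one⇒cover (r ◅ r′ ◅ s) drop =
    ⊥-elim (<-irrefl drop (≤-trans (s≤s (s≤s (rank-antitone s)))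
                                   (≤-trans (s≤s (rank-step r′)) (rank-step r))))

squeeze-1<2<3 : ∀ {a b c} → 1 ≤ a → a < b → b < c → c ≤ 3 → a ≡ 1 × b ≡ 2 × c ≡ 3
squeeze-1<2<3 {a} {b} {c} 1≤a a<b b<c c≤3 = a≡1 , b≡2 , c≡3
  where
  b≤2 : b ≤ 2
  b≤2 = ≤-pred (≤-trans b<c c≤3)
  2≤b : 2 ≤ b
  2≤b = ≤-trans (s≤s 1≤a) a<b
  a≡1 : a ≡ 1
  a≡1 = ≤-antisym (≤-pred (≤-trans a<b b≤2)) 1≤a
  b≡2 : b ≡ 2
  b≡2 = ≤-antisym b≤2 2≤b
  c≡3 : c ≡ 3
  c≡3 = ≤-antisym c≤3 (≤-trans (s≤s 2≤b) b<c)

strictly-increasing⇒r₀+m≤rₘ : (r : ℕ → ℕ) (m : ℕ) → (∀ e → e < m → r e < r (suc e)) →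
                              r 0 + m ≤ r m
strictly-increasing⇒r₀+m≤rₘ r zero    _    = ≤-reflexive (+-identityʳ (r 0))
strictly-increasing⇒r₀+m≤rₘ r (suc m) step = begin
  r 0 + suc m    ≡⟨ +-suc (r 0) m ⟩
  suc (r 0 + m)  ≤⟨ s≤s (strictly-increasing⇒r₀+m≤rₘ r m (λ e e<m → step e (m<n⇒m<1+n e<m))) ⟩
  suc (r m)      ≤⟨ step m (n<1+n m) ⟩
  r (suc m)      ∎
  where open ≤-Reasoning

rootCount : ∀ {A : Set} {k} → Vec (Maybe A) k → ℕ
rootCount []            = 0
rootCount (nothing ∷ v) = suc (rootCount v)
rootCount (just _ ∷ v)  = rootCount v

module _ {A : Set} where

  rootCount≤length : ∀ {k} (v : Vec (Maybe A) k) → rootCount v ≤ k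
  rootCount≤length []            = z≤n
  rootCount≤length (nothing ∷ v) = s≤s (rootCount≤length v)
  rootCount≤length (just _ ∷ v)  = m≤n⇒m≤1+n (rootCount≤length v)

  rootCount-pos : ∀ {k} (v : Vec (Maybe A) k) i → lookup v i ≡ nothing → 1 ≤ rootCount v
  rootCount-pos (nothing ∷ v) _       _  = s≤s z≤n
  rootCount-pos (just _ ∷ v)  (suc i) vi = rootCount-pos v i vi

  rootCount-attach : ∀ {k} (v : Vec (Maybe A) k) i x → lookup v i ≡ nothing →
                     suc (rootCount (v [ i ]≔ just x)) ≡ rootCount v
  rootCount-attach (nothing ∷ v) zero    x _  = refl
  rootCount-attach (nothing ∷ v) (suc i) x vi = cong suc (rootCount-attach v i x vi)
  rootCount-attach (just _ ∷ v)  (suc i) x vi = rootCount-attach v i x vi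

module _ {n : ℕ} where

  two-roots : ∀ (p : ParentMap n) {i j} → lookup p i ≡ nothing → lookup p j ≡ nothing →
              ¬ i ≡ j → 2 ≤ rootCount p
  two-roots p {i} {j} pi pj i≢j =
    subst (2 ≤_) (rootCount-attach p i j pi)
          (s≤s (rootCount-pos (p [ i ]≔ just j) j (trans (lookup∘update′ (i≢j ∘ sym) p (just j)) pj)))

  three-roots : ∀ (p : ParentMap n) {i j l} →
                lookup p i ≡ nothing → lookup p j ≡ nothing → lookup p l ≡ nothing →
                ¬ i ≡ j → ¬ i ≡ l → ¬ j ≡ l → 3 ≤ rootCount p
  three-roots p {i} {j} {l} pi pj pl i≢j i≢l j≢l =
    subst (3 ≤_) (rootCount-attach p i j pi)
          (s≤s (two-roots (p [ i ]≔ just j) (trans (lookup∘update′ (i≢j ∘ sym) p (just j)) pj)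
                          (trans (lookup∘update′ (i≢l ∘ sym) p (just j)) pl) j≢l))

  at-most-two-roots : ∀ (p : ParentMap n) {i j l} → rootCount p ≤ 2 →
                      lookup p i ≡ nothing → lookup p j ≡ nothing → lookup p l ≡ nothing →
                      ¬ i ≡ j → ¬ i ≡ l → j ≡ l
  at-most-two-roots p {j = j} {l} p≤2 pi pj pl i≢j i≢l with j ≟ l
  ... | yes j≡l = j≡l
  ... | no  j≢l = ⊥-elim (≤⇒≯ p≤2 (three-roots p pi pj pl i≢j i≢l j≢l))

module _ {n : ℕ} where

  Join : ParentMap n → Fin n → Fin n → ParentMap n → Set
  Join p a b q = ¬ a ≡ b × lookup p a ≡ nothing × lookup p b ≡ nothing × q ≡ p [ a ]≔ just b

  module _ {p q : ParentMap n} {a b : Fin n} where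

    join-parent : Join p a b q → lookup q a ≡ just b
    join-parent (_ , _ , _ , refl) = lookup∘update a p (just b)

    join-other : ∀ {i} → Join p a b q → ¬ i ≡ a → lookup q i ≡ lookup p i
    join-other (_ , _ , _ , refl) i≢a = lookup∘update′ i≢a p (just b)

    join-root : Join p a b q → lookup q b ≡ nothing
    join-root j@(a≢b , _ , pb , _) = trans (join-other j (a≢b ∘ sym)) pb

    join-rootCount : Join p a b q → suc (rootCount q) ≡ rootCount p
    join-rootCount (_ , pa , _ , refl) = rootCount-attach p a b pa

  -- z adds the edges a → b and b → d to p. An upper cover y ≠ x of p below z
  -- must add b → d, and then a → b no longer joins two roots of y.
  private
    no-square-moving-parent : ∀ {p x y z a b d a′ b′ c′ d′} →
      Join p a b x → Join x b d z → Join p a′ b′ y → Join y c′ d′ z → ¬ x ≡ y → ⊥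
    no-square-moving-parent {p} {x} {y} {z} {a} {b} {d} {a′} {b′} {c′} {d′}
                            jx@(a≢b , _ , _ , x≡) jz jy@(_ , pa′ , _ , y≡) jz′@(_ , yc′ , yd′ , _) x≢y
      = by-cases
      where
      za : lookup z a ≡ just b
      za = trans (join-other jz a≢b) (join-parent jx)
      z-elsewhere : ∀ {i} → ¬ i ≡ a → ¬ i ≡ b → lookup z i ≡ lookup p i
      z-elsewhere i≢a i≢b = trans (join-other jz i≢b) (join-other jx i≢a)
      c′≢a′ : ¬ c′ ≡ a′
      c′≢a′ refl = just≢nothing (trans (sym (join-parent jy)) yc′)
      za′ : lookup z a′ ≡ just b′
      za′ = trans (join-other jz′ (c′≢a′ ∘ sym)) (join-parent jy)
      zc′ : lookup z c′ ≡ just d′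
      zc′ = join-parent jz′

      by-cases : ⊥
      by-cases with a′ ≟ a | a′ ≟ b | c′ ≟ a
      ... | yes a′≡a | _ | _ =
        x≢y (trans x≡ (trans (cong₂ (λ i v → p [ i ]≔ just v) (sym a′≡a) b≡b′) (sym y≡)))
        where
        b≡b′ : b ≡ b′
        b≡b′ = just-injective (trans (sym za) (subst (λ i → lookup z i ≡ just b′) a′≡a za′))
      ... | no a′≢a | no a′≢b | _ =
        just≢nothing (trans (sym za′) (trans (z-elsewhere a′≢a a′≢b) pa′))
      ... | no _ | yes a′≡b | no c′≢a =
        just≢nothing (trans (sym zc′) (trans (z-elsewhere c′≢a c′≢b) (trans (sym (join-other jy c′≢a′)) yc′)))
        where
        c′≢b : ¬ c′ ≡ b
        c′≢b c′≡b = c′≢a′ (trans c′≡b (sym a′≡b))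
      ... | no _ | yes a′≡b | yes c′≡a =
        just≢nothing (trans (sym (join-parent jy)) (subst (λ i → lookup y i ≡ nothing) d′≡a′ yd′))
        where
        d′≡a′ : d′ ≡ a′
        d′≡a′ = trans (just-injective (trans (sym zc′) (subst (λ i → lookup z i ≡ just b) (sym c′≡a) za)))
                      (sym a′≡b)

  join-square-child≢parent : ∀ {p x y z a b c d a′ b′ c′ d′} →
    Join p a b x → Join x c d z → Join p a′ b′ y → Join y c′ d′ z → ¬ x ≡ y → ¬ c ≡ b
  join-square-child≢parent jx jz jy jz′ x≢y refl = no-square-moving-parent jx jz jy jz′ x≢y

  joins-avoiding-root-agree : ∀ {x z₁ z₂ b c₁ d₁ c₂ d₂} → rootCount x ≤ 2 → lookup x b ≡ nothing →
    Join x c₁ d₁ z₁ → Join x c₂ d₂ z₂ → ¬ c₁ ≡ b → ¬ c₂ ≡ b → z₁ ≡ z₂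
  joins-avoiding-root-agree {x} {z₁} {z₂} {b} {c₁} {d₁} {c₂} {d₂} x≤2 xb
    (c₁≢d₁ , xc₁ , xd₁ , z₁≡) (c₂≢d₂ , xc₂ , xd₂ , z₂≡) c₁≢b c₂≢b = begin
    z₁                  ≡⟨ z₁≡ ⟩
    x [ c₁ ]≔ just d₁   ≡⟨ cong₂ (λ c d → x [ c ]≔ just d) c₁≡c₂ (trans (sym b≡d₁) b≡d₂) ⟩
    x [ c₂ ]≔ just d₂   ≡⟨ sym z₂≡ ⟩
    z₂                  ∎
    where
    open ≡-Reasoning
    c₁≡c₂ : c₁ ≡ c₂
    c₁≡c₂ = at-most-two-roots x x≤2 xb xc₁ xc₂ (c₁≢b ∘ sym) (c₂≢b ∘ sym)
    b≡d₁ : b ≡ d₁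
    b≡d₁ = at-most-two-roots x x≤2 xc₁ xb xd₁ c₁≢b c₁≢d₁
    b≡d₂ : b ≡ d₂
    b≡d₂ = at-most-two-roots x x≤2 xc₂ xb xd₂ c₂≢b c₂≢d₂

module _ {n : ℕ} where

  rk : SF n → ℕ
  rk F = rootCount (proj₁ F)

  rk-cover : ∀ {F G : SF n} → F ⋖SF G → suc (rk G) ≡ rk F
  rk-cover (_ , _ , j) = join-rootCount j

  open Graded {R = _⋖SF_} rk (λ {F} {G} → rk-cover {F} {G}) public

  SF-≡ : ∀ {F G : SF n} → proj₁ F ≡ proj₁ G → F ≡ G
  SF-≡ {p , t} {.p , t′} refl = cong (p ,_) (T-irrelevant t t′)

reachesRoot⇒root : ∀ {n} (p : ParentMap n) fuel i → T (reachesRoot p fuel i) → ∃[ r ] lookup p r ≡ nothing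
reachesRoot⇒root p fuel i reach with lookup p i in pi
... | nothing = i , pi
... | just j with fuel
...   | suc k = reachesRoot⇒root p k j reach

module _ {n : ℕ} where

  rk-pos : (F : SF (suc n)) → 1 ≤ rk F
  rk-pos (p , forest) =
    let (r , pr) = reachesRoot⇒root p (suc n) zero (proj₁ (to T-∧ forest)) in rootCount-pos p r pr

  diamond-covers : ∀ {F X Y Z : SF (suc n)} → Diamond _⋖SF_ F X Y Z → rk F ≤ 3 →
                   rk X ≡ 2 × F ⋖SF X × X ⋖SF Z × F ⋖SF Y × Y ⋖SF Z
  diamond-covers {F} {X} {Y} {Z} D rkF≤3 with via X bottom<left left<top | via Y bottom<right right<top
    where
    open Diamond D
    via : ∀ M → StrictlyBelow _⋖SF_ F M → StrictlyBelow _⋖SF_ M Z → rk Z ≡ 1 × rk M ≡ 2 × rk F ≡ 3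
    via M F<M M<Z = squeeze-1<2<3 (rk-pos Z) (rank-decreases M<Z) (rank-decreases F<M) rkF≤3
  ... | rkZ≡1 , rkX≡2 , rkF≡3 | _ , rkY≡2 , _ =
    rkX≡2 , cover bottom<left rkX≡2 rkF≡3 , cover left<top rkZ≡1 rkX≡2
          , cover bottom<right rkY≡2 rkF≡3 , cover right<top rkZ≡1 rkY≡2
    where
    open Diamond D
    cover : ∀ {M M′ k} → StrictlyBelow _⋖SF_ M M′ → rk M′ ≡ k → rk M ≡ suc k → M ⋖SF M′
    cover (M≤M′ , _) rkM′≡k rkM≡1+k = rank-drop-one⇒cover M≤M′ (trans (cong suc rkM′≡k) (sym rkM≡1+k))

  diamonds-share-top : ∀ {F X Y₁ Z₁ Y₂ Z₂ : SF (suc n)} →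
    Diamond _⋖SF_ F X Y₁ Z₁ → Diamond _⋖SF_ F X Y₂ Z₂ → rk F ≤ 3 → Z₁ ≡ Z₂
  diamonds-share-top D₁ D₂ rkF≤3 with diamond-covers D₁ rkF≤3 | diamond-covers D₂ rkF≤3
  ... | rkX≡2 , (_ , _ , jx) , (_ , _ , jz₁) , (_ , _ , jy₁) , (_ , _ , jz₁′)
      | _     , _            , (_ , _ , jz₂) , (_ , _ , jy₂) , (_ , _ , jz₂′) =
    SF-≡ (joins-avoiding-root-agree (≤-reflexive rkX≡2) (join-root jx) jz₁ jz₂
            (join-square-child≢parent jx jz₁ jy₁ jz₁′ (Diamond.left≢right D₁ ∘ SF-≡))
            (join-square-child≢parent jx jz₂ jy₂ jz₂′ (Diamond.left≢right D₂ ∘ SF-≡)))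

allB-intro : ∀ {A : Set} (P : A → Bool) xs → (∀ x → T (P x)) → T (allB P xs)
allB-intro P []       _   = _
allB-intro P (x ∷ xs) all = from T-∧ (all x , allB-intro P xs all)

module _ {n : ℕ} where

  count-∷ : ∀ (i x : Fin n) xs → count i (x ∷ xs) ≡ (if does (i ≟ x) then suc else id) (count i xs)
  count-∷ i x xs with does (i ≟ x)
  ... | true  = refl
  ... | false = refl

  count-swap : ∀ (i x y : Fin n) zs → count i (x ∷ y ∷ zs) ≡ count i (y ∷ x ∷ zs)
  count-swap i x y zs
    rewrite count-∷ i x (y ∷ zs) | count-∷ i y zs | count-∷ i y (x ∷ zs) | count-∷ i x zs
    with does (i ≟ x) | does (i ≟ y)
  ... | false | _     = refl
  ... | true  | false = refl
  ... | true  | true  = refl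

  count-∷-cong : ∀ (i x : Fin n) {xs ys} → count i xs ≡ count i ys → count i (x ∷ xs) ≡ count i (x ∷ ys)
  count-∷-cong i x {xs} {ys} eq rewrite count-∷ i x xs | count-∷ i x ys = cong (if does (i ≟ x) then suc else id) eq

  count-↭ : ∀ (i : Fin n) {xs ys} → xs ↭ ys → count i xs ≡ count i ys
  count-↭ i Perm.refl                     = refl
  count-↭ i (Perm.prep x p)               = count-∷-cong i x (count-↭ i p)
  count-↭ i (Perm.swap {xs = xs} x y p)   =
    trans (count-swap i x y xs) (count-∷-cong i y (count-∷-cong i x (count-↭ i p)))
  count-↭ i (Perm.trans p q)              = trans (count-↭ i p) (count-↭ i q)

  count-suc-map : ∀ (i : Fin n) xs → count (suc i) (map suc xs) ≡ count i xs
  count-suc-map i []       = refl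
  count-suc-map i (j ∷ xs) with does (i ≟ j)
  ... | true  = cong suc (count-suc-map i xs)
  ... | false = count-suc-map i xs

  count-zero-map : ∀ (xs : List (Fin n)) → count zero (map suc xs) ≡ 0
  count-zero-map []       = refl
  count-zero-map (_ ∷ xs) = count-zero-map xs

allFin-suc : ∀ n → allFin (suc n) ≡ zero ∷ map suc (allFin n)
allFin-suc n = cong (zero ∷_) (sym (map-tabulate {n = n} id suc))

count-allFin : ∀ {n} (i : Fin n) → count i (allFin n) ≡ 1
count-allFin {suc n} zero    = trans (cong (count zero) (allFin-suc n)) (cong suc (count-zero-map (allFin n)))
count-allFin {suc n} (suc i) =
  trans (cong (count (suc i)) (allFin-suc n)) (trans (count-suc-map i (allFin n)) (count-allFin i))

module _ {n : ℕ} where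

  slotOK-just : ∀ (i : Fin n) t → ν t ≡ toℕ i → T (isBLT t) → T (slotOK i (just t))
  slotOK-just i t νt≡i blt = from T-∧ (≡⇒≡ᵇ (ν t) (toℕ i) νt≡i , blt)

  isFLyn-intro : (F : RawForest n) → (∀ i → T (slotOK i (lookup F i))) →
                 forestLeaves (toList F) ↭ allFin n → T (isFLyn F)
  isFLyn-intro F slots leaves↭ =
    from T-∧ ( allB-intro _ (allFin n) slots
             , allB-intro _ (allFin n) (λ i → ≡⇒≡ᵇ _ 1 (trans (count-↭ i leaves↭) (count-allFin i))))

  forestLeaves-nothings : ∀ k → forestLeaves (toList (replicate {A = Maybe (Tree n)} k nothing)) ≡ []
  forestLeaves-nothings zero    = refl
  forestLeaves-nothings (suc k) = forestLeaves-nothings k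

  FLyn-≢ : ∀ {F G : FLyn n} i → ¬ lookup (proj₁ F) i ≡ lookup (proj₁ G) i → ¬ F ≡ G
  FLyn-≢ i ne refl = ne refl

  merge-leaf : ∀ u (a : Fin n) t → merge u (leaf a) t ≡ node u (leaf a) t
  merge-leaf u a t with isBLT (node u (leaf a) t)
  ... | true  = refl
  ... | false = refl

  mergeLoop-done : ∀ fuel ctx (t : Tree n) → isBLT (plug ctx t) ≡ true → mergeLoop fuel ctx t ≡ plug ctx t
  mergeLoop-done fuel ctx t blt with isBLT (plug ctx t)
  mergeLoop-done fuel ctx t refl | true = refl

  mergeLoop-rotate : ∀ fuel ctx u c XL XR (Y : Tree n) → isBLT (plug ctx (node u (node c XL XR) Y)) ≡ false →
    mergeLoop (suc fuel) ctx (node u (node c XL XR) Y) ≡ mergeLoop fuel ((c , XR) ∷ ctx) (node u XL Y)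
  mergeLoop-rotate fuel ctx u c XL XR Y ¬blt with isBLT (plug ctx (node u (node c XL XR) Y))
  mergeLoop-rotate fuel ctx u c XL XR Y refl | false = refl

MergeStep : ∀ {n k} → Color → Vec (Maybe (Tree n)) k → Vec (Maybe (Tree n)) k → Set
MergeStep u v w =
  ∃[ i ] ∃[ j ] ∃[ Tᵢ ] ∃[ Tⱼ ]
    (toℕ i < toℕ j × lookup v i ≡ just Tᵢ × lookup v j ≡ just Tⱼ
    × w ≡ (v [ i ]≔ just (merge u Tᵢ Tⱼ)) [ j ]≔ nothing)

module _ {n : ℕ} where

  MergeStep-∷ : ∀ {k u x} {v w : Vec (Maybe (Tree n)) k} → MergeStep u v w → MergeStep u (x ∷ v) (x ∷ w)
  MergeStep-∷ (i , j , Tᵢ , Tⱼ , i<j , vi , vj , w≡) =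
    suc i , suc j , Tᵢ , Tⱼ , s≤s i<j , vi , vj , cong (_ ∷_) w≡

  MergeStep⇒≢ : ∀ {k u} {v w : Vec (Maybe (Tree n)) k} → MergeStep u v w → ¬ v ≡ w
  MergeStep⇒≢ {v = v} (i , j , Tᵢ , Tⱼ , _ , _ , vj , refl) v≡w =
    just≢nothing (trans (sym vj) (trans (cong (λ v → lookup v j) v≡w) (lookup∘update j (v [ i ]≔ _) nothing)))

  mergeStep⇒strictlyBelow : ∀ {u} {F G : FLyn n} → MergeStep u (proj₁ F) (proj₁ G) → StrictlyBelow _⋖FL_ F G
  mergeStep⇒strictlyBelow {u} step@(i , j , Tᵢ , Tⱼ , i<j , Fi , Fj , G≡) =
    (i , j , Tᵢ , Tⱼ , u , <⇒<ᵇ i<j , Fi , Fj , G≡) ◅ ε , MergeStep⇒≢ step ∘ cong proj₁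

comb : ∀ {n} k → (Fin (suc k) → Fin n) → Tree n
comb zero    ℓ = leaf (ℓ zero)
comb (suc k) ℓ = node false (leaf (ℓ zero)) (comb k (ℓ ∘ suc))

row : ∀ {n} k → (Fin k → Fin n) → ℕ → Vec (Maybe (Tree n)) k
row zero    ℓ _       = []
row (suc k) ℓ zero    = just (comb k ℓ) ∷ replicate k nothing
row (suc k) ℓ (suc e) = just (leaf (ℓ zero)) ∷ row k (ℓ ∘ suc) e

Consecutive : ∀ {n k} → (Fin (suc k) → Fin n) → Set
Consecutive ℓ = ∀ p → toℕ (ℓ p) ≡ toℕ (ℓ zero) + toℕ p

module _ {n : ℕ} where

  Consecutive-suc : ∀ {k} (ℓ : Fin (suc (suc k)) → Fin n) → Consecutive ℓ → Consecutive (ℓ ∘ suc)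
  Consecutive-suc ℓ consec p = begin
    toℕ (ℓ (suc p))                     ≡⟨ consec (suc p) ⟩
    toℕ (ℓ zero) + suc (toℕ p)          ≡⟨ +-suc (toℕ (ℓ zero)) (toℕ p) ⟩
    suc (toℕ (ℓ zero)) + toℕ p          ≡⟨ cong (_+ toℕ p) (+-comm 1 (toℕ (ℓ zero))) ⟩
    (toℕ (ℓ zero) + 1) + toℕ p          ≡⟨ cong (_+ toℕ p) (sym (consec (suc zero))) ⟩
    toℕ (ℓ (suc zero)) + toℕ p          ∎
    where open ≡-Reasoning

  ν-comb : ∀ k (ℓ : Fin (suc k) → Fin n) → Consecutive ℓ → ν (comb k ℓ) ≡ toℕ (ℓ zero)
  ν-comb zero    ℓ _      = refl
  ν-comb (suc k) ℓ consec = begin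
    toℕ (ℓ zero) ⊓ ν (comb k (ℓ ∘ suc))  ≡⟨ cong (toℕ (ℓ zero) ⊓_) ν-rest ⟩
    toℕ (ℓ zero) ⊓ (toℕ (ℓ zero) + 1)    ≡⟨ m≤n⇒m⊓n≡m (m≤m+n (toℕ (ℓ zero)) 1) ⟩
    toℕ (ℓ zero)                         ∎
    where
    open ≡-Reasoning
    ν-rest : ν (comb k (ℓ ∘ suc)) ≡ toℕ (ℓ zero) + 1
    ν-rest = trans (ν-comb k (ℓ ∘ suc) (Consecutive-suc ℓ consec)) (consec (suc zero))

  comb-isBLT : ∀ k (ℓ : Fin (suc k) → Fin n) → Consecutive ℓ → T (isBLT (comb k ℓ))
  comb-isBLT zero    ℓ _      = _
  comb-isBLT (suc k) ℓ consec =
    from T-∧ ( comb-isBLT k (ℓ ∘ suc) (Consecutive-suc ℓ consec)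
             , from T-∧ (≡⇒≡ᵇ _ _ (ν-comb (suc k) ℓ consec) , _))

  leaves-comb : ∀ k (ℓ : Fin (suc k) → Fin n) → leaves (comb k ℓ) ≡ tabulate ℓ
  leaves-comb zero    ℓ = refl
  leaves-comb (suc k) ℓ = cong (ℓ zero ∷_) (leaves-comb k (ℓ ∘ suc))

  row-leaves : ∀ k (ℓ : Fin k → Fin n) e → forestLeaves (toList (row k ℓ e)) ≡ tabulate ℓ
  row-leaves zero    ℓ _       = refl
  row-leaves (suc k) ℓ zero    = begin
    leaves (comb k ℓ) ++ forestLeaves (toList (replicate k nothing))
      ≡⟨ cong (leaves (comb k ℓ) ++_) (forestLeaves-nothings k) ⟩
    leaves (comb k ℓ) ++ []
      ≡⟨ ++-identityʳ _ ⟩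
    leaves (comb k ℓ)
      ≡⟨ leaves-comb k ℓ ⟩
    tabulate ℓ
      ∎
    where open ≡-Reasoning
  row-leaves (suc k) ℓ (suc e) = cong (ℓ zero ∷_) (row-leaves k (ℓ ∘ suc) e)

  row-slots : ∀ k (ℓ : Fin (suc k) → Fin n) e → Consecutive ℓ →
              ∀ p → T (slotOK (ℓ p) (lookup (row (suc k) ℓ e) p))
  row-slots k       ℓ zero    consec zero    =
    slotOK-just (ℓ zero) (comb k ℓ) (ν-comb k ℓ consec) (comb-isBLT k ℓ consec)
  row-slots k       ℓ zero    _      (suc p) = subst (T ∘ slotOK (ℓ (suc p))) (sym (lookup-replicate p nothing)) _
  row-slots k       ℓ (suc e) _      zero    = slotOK-just (ℓ zero) (leaf (ℓ zero)) refl _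
  row-slots (suc k) ℓ (suc e) consec (suc p) = row-slots k (ℓ ∘ suc) e (Consecutive-suc ℓ consec) p

  row-step : ∀ k (ℓ : Fin k → Fin n) e → suc e < k → MergeStep false (row k ℓ (suc e)) (row k ℓ e)
  row-step (suc (suc k)) ℓ zero    _         =
    zero , suc zero , leaf (ℓ zero) , comb k (ℓ ∘ suc) , z<s , refl , refl ,
    cong (λ t → just t ∷ nothing ∷ replicate k nothing) (sym (merge-leaf false (ℓ zero) _))
  row-step (suc k)       ℓ (suc e) (s≤s e<k) = MergeStep-∷ (row-step k (ℓ ∘ suc) e e<k)

module _ {n : ℕ} where

  combForest : ℕ → FLyn (suc n)
  combForest e = row (suc n) id e
               , isFLyn-intro (row (suc n) id e) (row-slots n id e (λ _ → refl))
                              (↭-reflexive (row-leaves (suc n) id e))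

  combForest-step : ∀ {e} → suc e < suc n → StrictlyBelow _⋖FL_ (combForest (suc e)) (combForest e)
  combForest-step {e} lt = mergeStep⇒strictlyBelow (row-step (suc n) id e lt)

module DiamondWitness (m : ℕ) where

  N : ℕ
  N = 3 + m

  t₀ t₁ S t₀S : Tree N
  t₀  = leaf zero
  t₁  = leaf (suc zero)
  S   = comb m (λ p → suc (suc p))
  t₀S = node true t₀ S

  ν-S : ν S ≡ 2
  ν-S = ν-comb m _ (λ _ → refl)

  S-isBLT : isBLT S ≡ true
  S-isBLT = to T-≡ (comb-isBLT m _ (λ _ → refl))

  t₀S-isBLT : isBLT t₀S ≡ true
  t₀S-isBLT rewrite S-isBLT = refl

  Z-isBLT : ∀ u → isBLT (node u t₀S t₁) ≡ true
  Z-isBLT u rewrite S-isBLT | ν-S = refl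

  Y-merge-not-BLT : ∀ u → isBLT (node true (node u t₀ t₁) S) ≡ false
  Y-merge-not-BLT u rewrite S-isBLT | ν-S = ∧-zeroʳ u

  merge-X→Z : ∀ u → merge u t₀S t₁ ≡ node u t₀S t₁
  merge-X→Z u = mergeLoop-done _ [] (node u t₀S t₁) (Z-isBLT u)

  merge-Y→Z : ∀ u → merge true (node u t₀ t₁) S ≡ node u t₀S t₁
  merge-Y→Z u = trans (mergeLoop-rotate 0 [] true u t₀ t₁ S (Y-merge-not-BLT u))
                      (mergeLoop-done 0 ((u , t₁) ∷ []) t₀S (Z-isBLT u))

  three : Maybe (Tree N) → Maybe (Tree N) → Maybe (Tree N) → RawForest N
  three a b c = a ∷ b ∷ c ∷ replicate m nothing

  three-forest : ∀ a b c → T (slotOK zero a) → T (slotOK (suc zero) b) → T (slotOK (suc (suc zero)) c) →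
                 forestLeaves (toList (three a b c)) ↭ allFin N → FLyn N
  three-forest a b c sa sb sc leaves↭ = three a b c , isFLyn-intro (three a b c) slots leaves↭
    where
    slots : ∀ i → T (slotOK i (lookup (three a b c) i))
    slots zero                = sa
    slots (suc zero)          = sb
    slots (suc (suc zero))    = sc
    slots (suc (suc (suc p))) = subst (T ∘ slotOK _) (sym (lookup-replicate p nothing)) _

  merge₀₁ : ∀ {u a b c t} → merge u a b ≡ t → MergeStep u (three (just a) (just b) c) (three (just t) nothing c)
  merge₀₁ refl = zero , suc zero , _ , _ , z<s , refl , refl , refl

  merge₀₂ : ∀ {u a b c t} → merge u a c ≡ t → MergeStep u (three (just a) b (just c)) (three (just t) b nothing)
  merge₀₂ refl = zero , suc (suc zero) , _ , _ , z<s , refl , refl , refl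

  F₀ : FLyn N
  F₀ = combForest 2

  F₀-leaves : forestLeaves (toList (proj₁ F₀)) ↭ allFin N
  F₀-leaves = ↭-reflexive (row-leaves N id 2)

  nothings : List (Fin N)
  nothings = forestLeaves (toList (replicate {A = Maybe (Tree N)} m nothing))

  X-leaves : forestLeaves (toList (three (just t₀S) (just t₁) nothing)) ↭ allFin N
  X-leaves = ↭-trans (Perm.prep zero (shift (suc zero) (leaves S) nothings)) F₀-leaves

  Z-leaves : ∀ u → forestLeaves (toList (three (just (node u t₀S t₁)) nothing nothing)) ↭ allFin N
  Z-leaves u = ↭-trans (↭-reflexive (cong (zero ∷_) (++-assoc (leaves S) (suc zero ∷ []) nothings))) X-leaves

  X : FLyn N
  X = three-forest (just t₀S) (just t₁) nothing
                   (slotOK-just zero t₀S refl (from T-≡ t₀S-isBLT)) _ _ X-leaves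

  Y : Color → FLyn N
  Y u = three-forest (just (node u t₀ t₁)) nothing (just S)
                     _ _ (slotOK-just (suc (suc zero)) S ν-S (from T-≡ S-isBLT)) F₀-leaves

  Z : Color → FLyn N
  Z u = three-forest (just (node u t₀S t₁)) nothing nothing
                     (slotOK-just zero (node u t₀S t₁) refl (from T-≡ (Z-isBLT u))) _ _ (Z-leaves u)

  diamond : ∀ u → Diamond _⋖FL_ F₀ X (Y u) (Z u)
  diamond u = record
    { bottom<left  = mergeStep⇒strictlyBelow (merge₀₂ (merge-leaf true zero S))
    ; left<top     = mergeStep⇒strictlyBelow (merge₀₁ (merge-X→Z u))
    ; bottom<right = mergeStep⇒strictlyBelow (merge₀₁ (merge-leaf u zero t₁))
    ; right<top    = mergeStep⇒strictlyBelow (merge₀₂ (merge-Y→Z u))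
    ; left≢right   = FLyn-≢ (suc zero) λ ()
    }

  Z-false≢Z-true : ¬ Z false ≡ Z true
  Z-false≢Z-true = FLyn-≢ zero λ ()

theorem5p6 : (n : ℕ) → 3 ≤ n → ¬ PosetIsomorphic n
theorem5p6 (suc (suc (suc m))) (s≤s (s≤s (s≤s z≤n))) (φ , iso) =
  Z-false≢Z-true (injective (diamonds-share-top (φ-diamond false) (φ-diamond true) rk-φF₀≤3))
  where
  open DiamondWitness m
  open IsOrderIsomorphism iso using (mono; injective)

  φ-diamond : ∀ u → Diamond _⋖SF_ (φ F₀) (φ X) (φ (Y u)) (φ (Z u))
  φ-diamond u = diamond-map mono injective (diamond u)

  -- F₀ = combForest 2 lies m covers above combForest (2 + m), the forest of singletons.
  rk-φF₀≤3 : rk (φ F₀) ≤ 3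
  rk-φF₀≤3 = +-cancelʳ-≤ m (rk (φ F₀)) 3
    (≤-trans (strictly-increasing⇒r₀+m≤rₘ (λ e → rk (φ (combForest (2 + e)))) m
               (λ e e<m → rank-decreases (strictlyBelow-map mono injective
                                            (combForest-step (s≤s (s≤s (s≤s e<m)))))))
             (rootCount≤length (proj₁ (φ (combForest (2 + m))))))
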